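{- Let $s\geq 1$ and $k\geq 1$ be integers, and let $n_1,n_2$ be positive integers with $n_1\geq sk+1$ and $n_2\geq sk$. Let $\mathcal{A}_{(1,1)}^{s,k}(n_1,n_2)$ be the set of $s$-separated $k$-element subsets of $[n_1,n_2]$ that contain the element $(1,1)$. Then \[ \left|\mathcal{A}_{(1,1)}^{s,k}(n_1,n_2)\right| = \binom{n_1+n_2-sk-1}{k-1}. \]
   Context: For positive integers $n_1,\dots,n_p$, let $[n]=\{1,\dots,n\}$ and $[n_1,\dots,n_p]=([n_1]\times\{1\})\cup\cdots\cup([n_p]\times\{p\})$; the elements with second coordinate $i$ are regarded as arranged in cyclic order $1,2,\dots,n_i$ around the $i$-th circle (so $n_i$ is followed by $1$). A subset of $[n_1,\dots,n_p]$ is $s$-separated if no two of its elements lie in the same circle with fewer than $s$ elements of that circle between them; i.e. for any two distinct elements $(a,i),(b,i)$ of the set in the same circle of size $n_i$, both $|a-b|-1\geq s$ and $n_i-|a-b|-1\geq s$. Elements in different circles impose no restriction. -}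

module Defs where

open import Data.Nat using (ℕ; _+_; _∸_; _≤_; suc; ∣_-_∣)
open import Data.Fin using (Fin; toℕ)
open import Data.Fin.Subset using (Subset; _∈_; ∣_∣)
open import Data.Product using (_×_; ∃; _,_)
open import Relation.Binary.PropositionalEquality using (_≡_)
open import Relation.Nullary using (¬_)

-- A circle of size n has elements 1..n; we represent element a by the
-- Fin n value with toℕ = a - 1 (distances are unchanged).
SeparatedOnCircle : (s n : ℕ) → Subset n → Set
SeparatedOnCircle s n A =
  ∀ (i j : Fin n) → i ∈ A → j ∈ A → ¬ (i ≡ j) →
    (s ≤ ∣ toℕ i - toℕ j ∣ ∸ 1) × (s ≤ n ∸ ∣ toℕ i - toℕ j ∣ ∸ 1)

-- A subset of [n₁,n₂] is a pair (A , B): A ⊆ circle 1, B ⊆ circle 2.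
Subset₂ : ℕ → ℕ → Set
Subset₂ n₁ n₂ = Subset n₁ × Subset n₂

Separated : (s n₁ n₂ : ℕ) → Subset₂ n₁ n₂ → Set
Separated s n₁ n₂ (A , B) = SeparatedOnCircle s n₁ A × SeparatedOnCircle s n₂ B

card₂ : ∀ {n₁ n₂} → Subset₂ n₁ n₂ → ℕ
card₂ (A , B) = ∣ A ∣ + ∣ B ∣

Contains₁₁ : ∀ {n₁ n₂} → Subset₂ n₁ n₂ → Set
Contains₁₁ {n₁} (A , B) = ∃ λ (i : Fin n₁) → toℕ i ≡ 0 × i ∈ A

InA : (s k n₁ n₂ : ℕ) → Subset₂ n₁ n₂ → Set
InA s k n₁ n₂ X = Separated s n₁ n₂ X × card₂ X ≡ k × Contains₁₁ X

module Submission where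

-- A pair
-- (A , B) is counted iff A is s-separated on circle 1, contains position 0
-- and has J + 1 elements, B is s-separated on circle 2 and has i elements,
-- and J + i = K where k = K + 1.  Hence the number of such pairs is the
-- convolution over J + i = K of
--   a(J) = #{anchored separated (J+1)-sets of circle 1} = C(n₁ − s(J+1) − 1, J),
--   c(i) = #{separated i-sets of circle 2} = (1+s)·C(X, i−1) + C(X, i),
--          X = n₂ − si − 1  (for i ≥ 1; c(0) = 1).
-- The convolution is then evaluated by the Hagen–Rothe identity, proved for
-- binomial coefficients with integer upper index (`HagenRothe`), giving
-- C(n₁ + n₂ − sk − 1, k − 1).

open import Data.Nat.Base using (ℕ)

-- Binomial coefficients by Pascal's recursion, so that the recurrence holds
-- definitionally; `choose≡C` connects them with the library's `_C_`.
module Binomial where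

  open import Data.Nat using (ℕ; zero; suc; _+_; _*_; _<_; z≤n; s≤s)
  open import Data.Nat.Properties
    using (*-distribˡ-+; +-assoc; *-identityˡ; *-identityʳ; *-zeroʳ; m<n⇒m<1+n; n<1+n)
  open import Data.Nat.Combinatorics using (_C_; k>n⇒nCk≡0; nCk+nC[k+1]≡[n+1]C[k+1])
  open import Relation.Binary.PropositionalEquality

  infix 10 _choose_
  _choose_ : ℕ → ℕ → ℕ
  n     choose zero  = 1
  zero  choose suc k = 0
  suc n choose suc k = n choose k + n choose suc k

  choose≡C : ∀ n k → n choose k ≡ n C k
  choose≡C n       zero    = refl
  choose≡C zero    (suc k) = sym (k>n⇒nCk≡0 {n = 0} {k = suc k} (s≤s z≤n))
  choose≡C (suc n) (suc k) =
    trans (cong₂ _+_ (choose≡C n k) (choose≡C n (suc k))) (nCk+nC[k+1]≡[n+1]C[k+1] n k)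

  choose-vanishes : ∀ {n k} → n < k → n choose k ≡ 0
  choose-vanishes {zero}  {suc k} _ = refl
  choose-vanishes {suc n} {suc k} (s≤s n<k) =
    cong₂ _+_ (choose-vanishes n<k) (choose-vanishes (m<n⇒m<1+n n<k))

  choose-diagonal : ∀ n → n choose n ≡ 1
  choose-diagonal zero    = refl
  choose-diagonal (suc n) = cong₂ _+_ (choose-diagonal n) (choose-vanishes (n<1+n n))

  choose-one : ∀ n → n choose 1 ≡ n
  choose-one zero    = refl
  choose-one (suc n) = cong suc (choose-one n)

  choose-absorb : ∀ n k → suc k * suc n choose suc k ≡ suc n * n choose k
  choose-absorb zero    zero    = refl
  choose-absorb zero    (suc k) = *-zeroʳ (suc (suc k))
  choose-absorb (suc n) zero    =
    trans (*-identityˡ _) (trans (choose-one (suc (suc n))) (sym (*-identityʳ (suc (suc n)))))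
  choose-absorb (suc n) (suc k) = begin
    suc (suc k) * (c₁ + suc n choose suc (suc k))
      ≡⟨ *-distribˡ-+ (suc (suc k)) c₁ _ ⟩
    suc (suc k) * c₁ + suc (suc k) * suc n choose suc (suc k)
      ≡⟨ cong (suc (suc k) * c₁ +_) (choose-absorb n (suc k)) ⟩
    c₁ + suc k * c₁ + suc n * n choose suc k
      ≡⟨ cong (λ x → c₁ + x + suc n * n choose suc k) (choose-absorb n k) ⟩
    c₁ + suc n * n choose k + suc n * n choose suc k
      ≡⟨ +-assoc c₁ _ _ ⟩
    c₁ + (suc n * n choose k + suc n * n choose suc k)
      ≡⟨ cong (c₁ +_) (sym (*-distribˡ-+ (suc n) (n choose k) _)) ⟩
    c₁ + suc n * c₁ ∎
    where
    open ≡-Reasoning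
    c₁ = suc n choose suc k

-- Convolution of two sequences over any carrier with an addition and a
-- multiplication:  convolution f g K = Σ_{J ≤ K} f J · g (K − J), computed by
-- recursion on K that shifts g.
module Convolution where

  open import Data.Nat using (ℕ; zero; suc; _≤_; z≤n; s≤s)
  open import Data.Nat.Properties using (≤-refl; m≤n⇒m≤1+n)
  open import Relation.Binary.PropositionalEquality

  convolution : {A : Set} → (A → A → A) → (A → A → A) → (ℕ → A) → (ℕ → A) → ℕ → A
  convolution _⊕_ _⊗_ f g zero    = f 0 ⊗ g 0
  convolution _⊕_ _⊗_ f g (suc K) = convolution _⊕_ _⊗_ f (λ i → g (suc i)) K ⊕ (f (suc K) ⊗ g 0)

  convolution-cong : ∀ {A : Set} (_⊕_ _⊗_ : A → A → A) {f f′ g g′} K →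
    (∀ J → J ≤ K → f J ≡ f′ J) → (∀ i → i ≤ K → g i ≡ g′ i) →
    convolution _⊕_ _⊗_ f g K ≡ convolution _⊕_ _⊗_ f′ g′ K
  convolution-cong _⊕_ _⊗_ zero    f≗ g≗ = cong₂ _⊗_ (f≗ 0 z≤n) (g≗ 0 z≤n)
  convolution-cong _⊕_ _⊗_ (suc K) f≗ g≗ =
    cong₂ _⊕_ (convolution-cong _⊕_ _⊗_ K (λ J J≤K → f≗ J (m≤n⇒m≤1+n J≤K)) (λ i i≤K → g≗ (suc i) (s≤s i≤K)))
              (cong₂ _⊗_ (f≗ (suc K) ≤-refl) (g≗ 0 z≤n))

-- Binomial coefficients with an arbitrary integer upper index, defined by
-- upper negation  C(−n−1, m) = (−1)^m C(n+m, m).  Pascal's rule then holds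
-- for every integer upper index.
module IntegerBinomial where

  open import Data.Nat as ℕ using (ℕ; zero; suc)
  open import Data.Nat.Properties using (+-comm; +-identityʳ; +-suc)
  open import Data.Integer using (ℤ; +_; -[1+_]; _+_; _-_; _*_; -_)
  open import Data.Integer.Properties using (pos-+)
  open import Data.Integer.Tactic.RingSolver using (solve-∀)
  open import Relation.Binary.PropositionalEquality
  open Binomial

  sign : ℕ → ℤ
  sign zero    = + 1
  sign (suc m) = - sign m

  binomℤ : ℤ → ℕ → ℤ
  binomℤ (+ n)    m = + (n choose m)
  binomℤ -[1+ n ] m = sign m * + ((n ℕ.+ m) choose m)

  binomℤ-zero : ∀ z → binomℤ z 0 ≡ + 1
  binomℤ-zero (+ n)    = refl
  binomℤ-zero -[1+ n ] = refl

  predecessor-negative : ∀ n → -[1+ n ] - + 1 ≡ -[1+ suc n ]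
  predecessor-negative n = cong (λ x → -[1+ suc x ]) (+-identityʳ n)

  binomℤ-pascal : ∀ z m → binomℤ z (suc m) ≡ binomℤ (z - + 1) (suc m) + binomℤ (z - + 1) m
  binomℤ-pascal (+ suc n) m =
    trans (cong +_ (+-comm (n choose m) _)) (pos-+ (n choose suc m) (n choose m))
  binomℤ-pascal (+ zero) m = sym (begin
    - sign m * + (suc m choose suc m) + sign m * + (m choose m)
      ≡⟨ cong₂ (λ a b → - sign m * + a + sign m * + b) (choose-diagonal (suc m)) (choose-diagonal m) ⟩
    - sign m * + 1 + sign m * + 1
      ≡⟨ cancel (sign m) ⟩
    + 0 ∎)
    where
    open ≡-Reasoning
    cancel : ∀ x → - x * + 1 + x * + 1 ≡ + 0
    cancel = solve-∀
  binomℤ-pascal -[1+ n ] m rewrite +-identityʳ n | +-suc n m = sym (begin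
    - sign m * + (c ℕ.+ c′) + sign m * + c
      ≡⟨ cong (λ t → - sign m * t + sign m * + c) (pos-+ c c′) ⟩
    - sign m * (+ c + + c′) + sign m * + c
      ≡⟨ cancel (sign m) (+ c) (+ c′) ⟩
    - sign m * + c′ ∎)
    where
    open ≡-Reasoning
    c  = suc (n ℕ.+ m) choose m
    c′ = suc (n ℕ.+ m) choose suc m
    cancel : ∀ x a b → - x * (a + b) + x * a ≡ - x * b
    cancel = solve-∀

  binomℤ-difference : ∀ z {z′} m → z′ ≡ z - + 1 → binomℤ z (suc m) - binomℤ z′ (suc m) ≡ binomℤ z′ m
  binomℤ-difference z m refl =
    trans (cong (_- binomℤ (z - + 1) (suc m)) (binomℤ-pascal z m)) (cancel (binomℤ (z - + 1) (suc m)) _)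
    where
    cancel : ∀ a b → a + b - a ≡ b
    cancel = solve-∀

-- The Hagen–Rothe convolution identity
--   Σ_{J ≤ K} C(u − sJ, J) · R(y, K − J) = C(u + y − sK, K),
-- where R(y, i) = y/(y − si)·C(y − si, i) is written without division as
-- R(y, i+1) = (1+s)·C(y − 1 − s(i+1), i) + C(y − 1 − s(i+1), i+1).
-- For fixed K both sides satisfy the same backward difference equation in y
-- (by induction on K), and they agree at y = 0, where R(0, i+1) = 0; this is
-- why the identity is proved for all integers u, y.
module HagenRothe (s : ℕ) where

  open import Data.Nat as ℕ using (ℕ; zero; suc)
  open import Data.Nat.Properties using (*-cancelˡ-≡; *-assoc; +-suc)
  open import Data.Nat.Tactic.RingSolver as ℕ-Solver using ()
  open import Data.Integer using (ℤ; +_; -[1+_]; _+_; _-_; _*_; -_)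
  open import Data.Integer.Properties
    using (pos-*; *-zeroʳ; *-identityʳ; +-identityˡ; +-identityʳ)
  open import Data.Integer.Tactic.RingSolver using (solve-∀)
  open import Relation.Binary.PropositionalEquality
  open Binomial
  open Convolution
  open IntegerBinomial

  S : ℤ
  S = + s

  conv : (ℕ → ℤ) → (ℕ → ℤ) → ℕ → ℤ
  conv = convolution _+_ _*_

  conv-sub : ∀ f g h K → conv f g K - conv f h K ≡ conv f (λ i → g i - h i) K
  conv-sub f g h zero    = distrib (f 0) (g 0) (h 0)
    where
    distrib : ∀ a b c → a * b - a * c ≡ a * (b - c)
    distrib = solve-∀
  conv-sub f g h (suc K) =
    trans (regroup (conv f (λ i → g (suc i)) K) (conv f (λ i → h (suc i)) K) (f (suc K)) (g 0) (h 0))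
          (cong (_+ f (suc K) * (g 0 - h 0)) (conv-sub f _ _ K))
    where
    regroup : ∀ A B c x y → (A + c * x) - (B + c * y) ≡ (A - B) + c * (x - y)
    regroup = solve-∀

  conv-unit : ∀ f g K → g 0 ≡ + 1 → (∀ i → g (suc i) ≡ + 0) → conv f g K ≡ f K
  conv-unit f g zero    g₀ _  = trans (cong (f 0 *_) g₀) (*-identityʳ (f 0))
  conv-unit f g (suc K) g₀ g₊ =
    trans (cong₂ _+_ (conv-null K g₊) (trans (cong (f (suc K) *_) g₀) (*-identityʳ (f (suc K)))))
          (+-identityˡ (f (suc K)))
    where
    conv-null : ∀ {h} K → (∀ i → h i ≡ + 0) → conv f h K ≡ + 0
    conv-null zero    h≡0 = trans (cong (f 0 *_) (h≡0 0)) (*-zeroʳ (f 0))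
    conv-null (suc K) h≡0 =
      cong₂ _+_ (conv-null K (λ i → h≡0 (suc i))) (trans (cong (f (suc K) *_) (h≡0 0)) (*-zeroʳ (f (suc K))))

  rothe : ℤ → ℕ → ℤ
  rothe y zero    = + 1
  rothe y (suc i) = (+ 1 + S) * binomℤ (y - (+ 1 + S * + suc i)) i + binomℤ (y - (+ 1 + S * + suc i)) (suc i)

  rothe-difference : ∀ y i → rothe y (suc i) - rothe (y - + 1) (suc i) ≡ rothe (y - (+ 1 + S)) i
  rothe-difference y i = begin
    rothe y (suc i) - rothe (y - + 1) (suc i)
      ≡⟨ regroup (+ 1 + S) (binomℤ a i) (binomℤ a (suc i)) (binomℤ a′ i) (binomℤ a′ (suc i)) ⟩
    (+ 1 + S) * (binomℤ a i - binomℤ a′ i) + (binomℤ a (suc i) - binomℤ a′ (suc i))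
      ≡⟨ cong (λ t → (+ 1 + S) * (binomℤ a i - binomℤ a′ i) + t) (binomℤ-difference a i (shift y _)) ⟩
    (+ 1 + S) * (binomℤ a i - binomℤ a′ i) + binomℤ a′ i
      ≡⟨ lower i ⟩
    rothe (y - (+ 1 + S)) i ∎
    where
    open ≡-Reasoning
    a  = y - (+ 1 + S * + suc i)
    a′ = y - + 1 - (+ 1 + S * + suc i)
    regroup : ∀ c A B A′ B′ → (c * A + B) - (c * A′ + B′) ≡ c * (A - A′) + (B - B′)
    regroup = solve-∀
    shift : ∀ y c → y - + 1 - c ≡ y - c - + 1
    shift = solve-∀
    reindex : ∀ y S X → y - + 1 - (+ 1 + S * (+ 1 + X)) ≡ y - (+ 1 + S) - (+ 1 + S * X)
    reindex = solve-∀
    lower : ∀ i → (+ 1 + S) * (binomℤ (y - (+ 1 + S * + suc i)) i - binomℤ (y - + 1 - (+ 1 + S * + suc i)) i)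
                    + binomℤ (y - + 1 - (+ 1 + S * + suc i)) i ≡ rothe (y - (+ 1 + S)) i
    lower zero    = trans (cong₂ (λ b b′ → (+ 1 + S) * (b - b′) + b′)
                                 (binomℤ-zero (y - (+ 1 + S * + 1))) (binomℤ-zero (y - + 1 - (+ 1 + S * + 1))))
                          (vanish (+ 1 + S))
      where
      vanish : ∀ c → c * (+ 1 - + 1) + + 1 ≡ + 1
      vanish = solve-∀
    lower (suc i) = cong₂ (λ b b′ → (+ 1 + S) * b + b′)
      (trans (binomℤ-difference (y - (+ 1 + S * + suc (suc i))) i (shift y (+ 1 + S * + suc (suc i))))
             (cong (λ z → binomℤ z i) (reindex y S (+ suc i))))
      (cong (λ z → binomℤ z (suc i)) (reindex y S (+ suc i)))

  -- R(0, i+1) = 0; it rests on the absorption identity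
  -- C((s+1)(i+1), i+1) = (s+1)·C((s+1)(i+1) − 1, i).
  rothe-at-zero : ∀ i → rothe (+ 0) (suc i) ≡ + 0
  rothe-at-zero i = begin
    rothe (+ 0) (suc i)
      ≡⟨ cong (λ z → (+ 1 + S) * binomℤ z i + binomℤ z (suc i)) at-zero ⟩
    (+ 1 + S) * (sign i * + c) + - sign i * + ((n ℕ.+ suc i) choose suc i)
      ≡⟨ cong (λ t → (+ 1 + S) * (sign i * + c) + - sign i * t) (trans (cong +_ absorbed) (pos-* (suc s) c)) ⟩
    (+ 1 + S) * (sign i * + c) + - sign i * ((+ 1 + S) * + c)
      ≡⟨ cancel (+ 1 + S) (sign i) (+ c) ⟩
    + 0 ∎
    where
    open ≡-Reasoning
    n = s ℕ.* suc i
    c = (n ℕ.+ i) choose i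
    at-zero : + 0 - (+ 1 + S * + suc i) ≡ -[1+ n ]
    at-zero = cong (λ t → + 0 - (+ 1 + t)) (sym (pos-* s (suc i)))
    factor : ∀ s i → suc (s ℕ.* suc i ℕ.+ i) ≡ suc i ℕ.* suc s
    factor = ℕ-Solver.solve-∀
    absorbed : (n ℕ.+ suc i) choose suc i ≡ suc s ℕ.* c
    absorbed = *-cancelˡ-≡ _ _ (suc i) (begin
      suc i ℕ.* ((n ℕ.+ suc i) choose suc i) ≡⟨ cong (λ t → suc i ℕ.* (t choose suc i)) (+-suc n i) ⟩
      suc i ℕ.* (suc (n ℕ.+ i) choose suc i) ≡⟨ choose-absorb (n ℕ.+ i) i ⟩
      suc (n ℕ.+ i) ℕ.* c                    ≡⟨ cong (ℕ._* c) (factor s i) ⟩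
      suc i ℕ.* suc s ℕ.* c                  ≡⟨ *-assoc (suc i) (suc s) c ⟩
      suc i ℕ.* (suc s ℕ.* c) ∎)
    cancel : ∀ c g B → c * (g * B) + - g * (c * B) ≡ + 0
    cancel = solve-∀

  step-invariant-constant : (D : ℤ → ℤ) → (∀ y → D y ≡ D (y - + 1)) → ∀ y → D y ≡ D (+ 0)
  step-invariant-constant D step (+ zero)     = refl
  step-invariant-constant D step (+ suc n)    = trans (step (+ suc n)) (step-invariant-constant D step (+ n))
  step-invariant-constant D step -[1+ zero ]  = sym (step (+ 0))
  step-invariant-constant D step -[1+ suc n ] =
    trans (sym (trans (step -[1+ n ]) (cong D (predecessor-negative n))))
          (step-invariant-constant D step -[1+ n ])

  difference-unique : (f g : ℤ → ℤ) → (∀ y → f y - f (y - + 1) ≡ g y - g (y - + 1)) →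
    f (+ 0) ≡ g (+ 0) → ∀ y → f y ≡ g y
  difference-unique f g Δ≡ f₀≡g₀ y = begin
    f y               ≡⟨ split (f y) (g y) ⟩
    (f y - g y) + g y ≡⟨ cong (_+ g y) (step-invariant-constant (λ y → f y - g y) step y) ⟩
    (f (+ 0) - g (+ 0)) + g y ≡⟨ cong (λ x → (x - g (+ 0)) + g y) f₀≡g₀ ⟩
    (g (+ 0) - g (+ 0)) + g y ≡⟨ cancel (g (+ 0)) (g y) ⟩
    g y ∎
    where
    open ≡-Reasoning
    split : ∀ a b → a ≡ (a - b) + b
    split = solve-∀
    cancel : ∀ x y → (x - x) + y ≡ y
    cancel = solve-∀
    rearrange : ∀ a a′ b b′ → a - b ≡ (a - a′) - (b - b′) + (a′ - b′)
    rearrange = solve-∀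
    step : ∀ y → f y - g y ≡ f (y - + 1) - g (y - + 1)
    step y = begin
      f y - g y
        ≡⟨ rearrange (f y) (f (y - + 1)) (g y) (g (y - + 1)) ⟩
      (f y - f (y - + 1)) - (g y - g (y - + 1)) + (f (y - + 1) - g (y - + 1))
        ≡⟨ cong (λ t → t - (g y - g (y - + 1)) + (f (y - + 1) - g (y - + 1))) (Δ≡ y) ⟩
      (g y - g (y - + 1)) - (g y - g (y - + 1)) + (f (y - + 1) - g (y - + 1))
        ≡⟨ cancel (g y - g (y - + 1)) _ ⟩
      f (y - + 1) - g (y - + 1) ∎

  hagen-rothe : ∀ K u y → conv (λ J → binomℤ (u - S * + J) J) (rothe y) K ≡ binomℤ (u + y - S * + K) K
  hagen-rothe zero    u y =
    trans (cong (_* + 1) (binomℤ-zero (u - S * + 0))) (sym (binomℤ-zero (u + y - S * + 0)))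
  hagen-rothe (suc K) u = difference-unique lhs rhs Δ≡ base
    where
    open ≡-Reasoning
    F : ℕ → ℤ
    F J = binomℤ (u - S * + J) J
    lhs rhs : ℤ → ℤ
    lhs y = conv F (rothe y) (suc K)
    rhs y = binomℤ (u + y - S * + suc K) (suc K)
    reindex₁ : ∀ u y S K → u + y - S * (+ 1 + K) - + 1 ≡ u + (y - + 1) - S * (+ 1 + K)
    reindex₁ = solve-∀
    reindex₂ : ∀ u y S K → u + (y - + 1) - S * (+ 1 + K) ≡ u + (y - (+ 1 + S)) - S * K
    reindex₂ = solve-∀
    Δ≡ : ∀ y → lhs y - lhs (y - + 1) ≡ rhs y - rhs (y - + 1)
    Δ≡ y = begin
      lhs y - lhs (y - + 1)
        ≡⟨ conv-sub F (rothe y) (rothe (y - + 1)) (suc K) ⟩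
      conv F (λ i → rothe y (suc i) - rothe (y - + 1) (suc i)) K + F (suc K) * (+ 1 - + 1)
        ≡⟨ cong₂ _+_ (convolution-cong _+_ _*_ K (λ _ _ → refl) (λ i _ → rothe-difference y i))
                     (*-zeroʳ (F (suc K))) ⟩
      conv F (rothe (y - (+ 1 + S))) K + + 0
        ≡⟨ +-identityʳ _ ⟩
      conv F (rothe (y - (+ 1 + S))) K
        ≡⟨ hagen-rothe K u (y - (+ 1 + S)) ⟩
      binomℤ (u + (y - (+ 1 + S)) - S * + K) K
        ≡⟨ cong (λ z → binomℤ z K) (sym (reindex₂ u y S (+ K))) ⟩
      binomℤ (u + (y - + 1) - S * + suc K) K
        ≡⟨ sym (binomℤ-difference (u + y - S * + suc K) K (sym (reindex₁ u y S (+ K)))) ⟩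
      rhs y - rhs (y - + 1) ∎
    base : lhs (+ 0) ≡ rhs (+ 0)
    base = trans (conv-unit F (rothe (+ 0)) (suc K) refl rothe-at-zero)
                 (cong (λ w → binomℤ (w - S * + suc K) (suc K)) (sym (+-identityʳ u)))

module BooleanVectors where

  open import Data.Nat using (ℕ; zero; suc; _+_; _*_)
  open import Data.Nat.Properties using (+-identityʳ; *-distribˡ-+; *-comm)
  open import Data.Nat.Tactic.RingSolver using (solve-∀)
  open import Data.Bool using (Bool; true; false; _∧_; T)
  open import Data.Bool.Properties using (T?)
  open import Data.Vec using (Vec; []; _∷_)
  open import Data.List using (List; []; _∷_; map; _++_; filter; length; cartesianProduct)
  open import Data.List.Properties using (map-++; map-∘; map-cong)
  open import Data.Nat.ListAction using (sum)
  open import Data.Nat.ListAction.Properties using (sum-++)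
  open import Data.List.Membership.Propositional using (_∈_)
  open import Data.List.Membership.Propositional.Properties using (∈-++⁺ˡ; ∈-++⁺ʳ; ∈-map⁺; ∈-map⁻)
  open import Data.List.Relation.Unary.Any using (here)
  open import Data.List.Relation.Unary.All using ([])
  open import Data.List.Relation.Unary.AllPairs using ([]; _∷_)
  open import Data.List.Relation.Unary.Unique.Propositional using (Unique)
  import Data.List.Relation.Unary.Unique.Propositional.Properties as Unique
  open import Data.Product using (_×_; _,_)
  open import Data.Empty using (⊥; ⊥-elim)
  open import Relation.Nullary using (¬_)
  open import Function using (_∘_)
  open import Relation.Binary.PropositionalEquality

  allVecs : (n : ℕ) → List (Vec Bool n)
  allVecs zero    = [] ∷ []
  allVecs (suc n) = map (true ∷_) (allVecs n) ++ map (false ∷_) (allVecs n)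

  allVecs-complete : ∀ n (v : Vec Bool n) → v ∈ allVecs n
  allVecs-complete zero    []         = here refl
  allVecs-complete (suc n) (true ∷ v)  = ∈-++⁺ˡ (∈-map⁺ (true ∷_) (allVecs-complete n v))
  allVecs-complete (suc n) (false ∷ v) =
    ∈-++⁺ʳ (map (true ∷_) (allVecs n)) (∈-map⁺ (false ∷_) (allVecs-complete n v))

  allVecs-unique : ∀ n → Unique (allVecs n)
  allVecs-unique zero    = [] ∷ []
  allVecs-unique (suc n) = Unique.++⁺ (Unique.map⁺ tail-injective (allVecs-unique n))
                                      (Unique.map⁺ tail-injective (allVecs-unique n)) disjoint
    where
    tail-injective : ∀ {b : Bool} {x y : Vec Bool n} → b ∷ x ≡ b ∷ y → x ≡ y
    tail-injective refl = refl
    disjoint : ∀ {v} → v ∈ map (true ∷_) (allVecs n) × v ∈ map (false ∷_) (allVecs n) → ⊥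
    disjoint (p , q) with ∈-map⁻ (true ∷_) p | ∈-map⁻ (false ∷_) q
    ... | _ , _ , refl | _ , _ , ()

  Σᵥ : (n : ℕ) → (Vec Bool n → ℕ) → ℕ
  Σᵥ zero    f = f []
  Σᵥ (suc n) f = Σᵥ n (λ v → f (true ∷ v)) + Σᵥ n (λ v → f (false ∷ v))

  Σᵥ-cong : ∀ n {f g : Vec Bool n → ℕ} → (∀ v → f v ≡ g v) → Σᵥ n f ≡ Σᵥ n g
  Σᵥ-cong zero    f≗g = f≗g []
  Σᵥ-cong (suc n) f≗g = cong₂ _+_ (Σᵥ-cong n (f≗g ∘ (true ∷_))) (Σᵥ-cong n (f≗g ∘ (false ∷_)))

  Σᵥ-+ : ∀ n (f g : Vec Bool n → ℕ) → Σᵥ n (λ v → f v + g v) ≡ Σᵥ n f + Σᵥ n g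
  Σᵥ-+ zero    f g = refl
  Σᵥ-+ (suc n) f g = trans (cong₂ _+_ (Σᵥ-+ n _ _) (Σᵥ-+ n _ _))
    (interchange (Σᵥ n (f ∘ (true ∷_))) (Σᵥ n (g ∘ (true ∷_))) (Σᵥ n (f ∘ (false ∷_))) (Σᵥ n (g ∘ (false ∷_))))
    where
    interchange : ∀ a b c d → (a + b) + (c + d) ≡ (a + c) + (b + d)
    interchange = solve-∀

  Σᵥ-scale : ∀ n c (f : Vec Bool n → ℕ) → Σᵥ n (λ v → c * f v) ≡ c * Σᵥ n f
  Σᵥ-scale zero    c f = refl
  Σᵥ-scale (suc n) c f = trans (cong₂ _+_ (Σᵥ-scale n c _) (Σᵥ-scale n c _)) (sym (*-distribˡ-+ c _ _))

  Σᵥ-scaleʳ : ∀ n c (f : Vec Bool n → ℕ) → Σᵥ n (λ v → f v * c) ≡ Σᵥ n f * c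
  Σᵥ-scaleʳ n c f = trans (Σᵥ-cong n (λ v → *-comm (f v) c)) (trans (Σᵥ-scale n c f) (*-comm c (Σᵥ n f)))

  Σᵥ-zero : ∀ n → Σᵥ n (λ _ → 0) ≡ 0
  Σᵥ-zero zero    = refl
  Σᵥ-zero (suc n) = cong₂ _+_ (Σᵥ-zero n) (Σᵥ-zero n)

  Σᵥ-sum : ∀ n (f : Vec Bool n → ℕ) → sum (map f (allVecs n)) ≡ Σᵥ n f
  Σᵥ-sum zero    f = +-identityʳ (f [])
  Σᵥ-sum (suc n) f = begin
    sum (map f (map (true ∷_) (allVecs n) ++ map (false ∷_) (allVecs n)))
      ≡⟨ cong sum (map-++ f (map (true ∷_) (allVecs n)) _) ⟩
    sum (map f (map (true ∷_) (allVecs n)) ++ map f (map (false ∷_) (allVecs n)))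
      ≡⟨ sum-++ (map f (map (true ∷_) (allVecs n))) _ ⟩
    sum (map f (map (true ∷_) (allVecs n))) + sum (map f (map (false ∷_) (allVecs n)))
      ≡⟨ cong₂ _+_ (cong sum (sym (map-∘ (allVecs n)))) (cong sum (sym (map-∘ (allVecs n)))) ⟩
    sum (map (f ∘ (true ∷_)) (allVecs n)) + sum (map (f ∘ (false ∷_)) (allVecs n))
      ≡⟨ cong₂ _+_ (Σᵥ-sum n _) (Σᵥ-sum n _) ⟩
    Σᵥ (suc n) f ∎
    where open ≡-Reasoning

  ⟦_⟧ : Bool → ℕ
  ⟦ true  ⟧ = 1
  ⟦ false ⟧ = 0

  ⟦∧⟧ : ∀ a b → ⟦ a ∧ b ⟧ ≡ ⟦ a ⟧ * ⟦ b ⟧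
  ⟦∧⟧ true  true  = refl
  ⟦∧⟧ true  false = refl
  ⟦∧⟧ false b     = refl

  ⟦⟧-true : ∀ {x} → T x → ⟦ x ⟧ ≡ 1
  ⟦⟧-true {true} _ = refl

  ⟦⟧-false : ∀ {x} → ¬ T x → ⟦ x ⟧ ≡ 0
  ⟦⟧-false {true}  ¬⊤ = ⊥-elim (¬⊤ _)
  ⟦⟧-false {false} _  = refl

  length-filter : ∀ {A : Set} (c : A → Bool) xs → length (filter (T? ∘ c) xs) ≡ sum (map (⟦_⟧ ∘ c) xs)
  length-filter c []       = refl
  length-filter c (x ∷ xs) with c x
  ... | true  = cong suc (length-filter c xs)
  ... | false = length-filter c xs

  sum-cartesianProduct : ∀ {A B : Set} (g : A × B → ℕ) xs ys →
    sum (map g (cartesianProduct xs ys)) ≡ sum (map (λ x → sum (map (λ y → g (x , y)) ys)) xs)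
  sum-cartesianProduct g []       ys = refl
  sum-cartesianProduct g (x ∷ xs) ys = begin
    sum (map g (map (x ,_) ys ++ cartesianProduct xs ys))
      ≡⟨ cong sum (map-++ g (map (x ,_) ys) _) ⟩
    sum (map g (map (x ,_) ys) ++ map g (cartesianProduct xs ys))
      ≡⟨ sum-++ (map g (map (x ,_) ys)) _ ⟩
    sum (map g (map (x ,_) ys)) + sum (map g (cartesianProduct xs ys))
      ≡⟨ cong₂ _+_ (cong sum (sym (map-∘ ys))) (sum-cartesianProduct g xs ys) ⟩
    sum (map (λ y → g (x , y)) ys) + sum (map (λ x → sum (map (λ y → g (x , y)) ys)) xs) ∎
    where open ≡-Reasoning

  count-pairs : ∀ n₁ n₂ (c : Vec Bool n₁ × Vec Bool n₂ → Bool) →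
    length (filter (T? ∘ c) (cartesianProduct (allVecs n₁) (allVecs n₂)))
      ≡ Σᵥ n₁ (λ A → Σᵥ n₂ (λ B → ⟦ c (A , B) ⟧))
  count-pairs n₁ n₂ c = begin
    length (filter (T? ∘ c) (cartesianProduct (allVecs n₁) (allVecs n₂)))
      ≡⟨ length-filter c (cartesianProduct (allVecs n₁) (allVecs n₂)) ⟩
    sum (map (⟦_⟧ ∘ c) (cartesianProduct (allVecs n₁) (allVecs n₂)))
      ≡⟨ sum-cartesianProduct (⟦_⟧ ∘ c) (allVecs n₁) (allVecs n₂) ⟩
    sum (map (λ A → sum (map (λ B → ⟦ c (A , B) ⟧) (allVecs n₂))) (allVecs n₁))
      ≡⟨ cong sum (map-cong (λ A → Σᵥ-sum n₂ (λ B → ⟦ c (A , B) ⟧)) (allVecs n₁)) ⟩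
    sum (map (λ A → Σᵥ n₂ (λ B → ⟦ c (A , B) ⟧)) (allVecs n₁))
      ≡⟨ Σᵥ-sum n₁ _ ⟩
    Σᵥ n₁ (λ A → Σᵥ n₂ (λ B → ⟦ c (A , B) ⟧)) ∎
    where open ≡-Reasoning

module NaturalConvolution where

  open import Data.Nat using (zero; suc; _+_; _*_; _≡ᵇ_; _≟_)
  open import Data.Nat.Properties
    using (*-identityʳ; *-zeroʳ; *-assoc; +-identityʳ; +-suc; ≡⇒≡ᵇ; ≡ᵇ⇒≡)
  open import Data.Nat.Tactic.RingSolver using (solve-∀)
  open import Data.Bool using (Bool; T; _∧_)
  open import Data.Vec using (Vec)
  open import Data.Integer as ℤ using (+_)
  open import Data.Integer.Properties using (pos-+; pos-*)
  open import Relation.Nullary using (yes; no)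
  open import Function using (_∘_)
  open import Relation.Binary.PropositionalEquality
  open Convolution
  open BooleanVectors

  convℕ : (ℕ → ℕ) → (ℕ → ℕ) → ℕ → ℕ
  convℕ = convolution _+_ _*_

  convℕ-zeroʳ : ∀ f {g} K → (∀ i → g i ≡ 0) → convℕ f g K ≡ 0
  convℕ-zeroʳ f zero    g≡0 = trans (cong (f 0 *_) (g≡0 0)) (*-zeroʳ (f 0))
  convℕ-zeroʳ f (suc K) g≡0 =
    cong₂ _+_ (convℕ-zeroʳ f K (g≡0 ∘ suc)) (trans (cong (f (suc K) *_) (g≡0 0)) (*-zeroʳ (f (suc K))))

  convℕ-scale : ∀ x y f g K → convℕ (λ J → x * f J) (λ i → y * g i) K ≡ x * y * convℕ f g K
  convℕ-scale x y f g zero    = regroup x y (f 0) (g 0)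
    where
    regroup : ∀ x y a b → x * a * (y * b) ≡ x * y * (a * b)
    regroup = solve-∀
  convℕ-scale x y f g (suc K) =
    trans (cong (_+ x * f (suc K) * (y * g 0)) (convℕ-scale x y f (g ∘ suc) K))
          (regroup x y (convℕ f (g ∘ suc) K) (f (suc K)) (g 0))
    where
    regroup : ∀ x y c a b → x * y * c + x * a * (y * b) ≡ x * y * (c + a * b)
    regroup = solve-∀

  convℕ-indicators : ∀ a b K → convℕ (λ J → ⟦ a ≡ᵇ J ⟧) (λ i → ⟦ b ≡ᵇ i ⟧) K ≡ ⟦ a + b ≡ᵇ K ⟧
  convℕ-indicators zero    zero    zero    = refl
  convℕ-indicators zero    (suc b) zero    = refl
  convℕ-indicators (suc a) b       zero    = refl
  convℕ-indicators a       zero    (suc K) =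
    trans (cong₂ _+_ (convℕ-zeroʳ _ K (λ _ → refl)) (*-identityʳ _))
          (cong (λ x → ⟦ x ≡ᵇ suc K ⟧) (sym (+-identityʳ a)))
  convℕ-indicators a       (suc b) (suc K) =
    trans (cong₂ _+_ (convℕ-indicators a b K) (*-zeroʳ ⟦ a ≡ᵇ suc K ⟧))
          (trans (+-identityʳ _) (cong (λ x → ⟦ x ≡ᵇ suc K ⟧) (sym (+-suc a b))))

  indicator-at : ∀ (P : ℕ → Bool) a → (∀ J → T (P J) → J ≡ a) → ∀ J → ⟦ P J ⟧ ≡ ⟦ P a ⟧ * ⟦ a ≡ᵇ J ⟧
  indicator-at P a unique J with J ≟ a
  ... | yes refl = sym (trans (cong (⟦ P J ⟧ *_) (⟦⟧-true (≡⇒≡ᵇ J J refl))) (*-identityʳ ⟦ P J ⟧))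
  ... | no  J≢a  = trans (⟦⟧-false (J≢a ∘ unique J))
                         (sym (trans (cong (⟦ P a ⟧ *_) (⟦⟧-false (J≢a ∘ sym ∘ ≡ᵇ⇒≡ a J))) (*-zeroʳ ⟦ P a ⟧)))

  convℕ-tests : ∀ (P Q : ℕ → Bool) a b → (∀ J → T (P J) → J ≡ a) → (∀ i → T (Q i) → i ≡ b) →
    ∀ K → convℕ (λ J → ⟦ P J ⟧) (λ i → ⟦ Q i ⟧) K ≡ ⟦ P a ∧ (Q b ∧ (a + b ≡ᵇ K)) ⟧
  convℕ-tests P Q a b uniqueP uniqueQ K = begin
    convℕ (λ J → ⟦ P J ⟧) (λ i → ⟦ Q i ⟧) K
      ≡⟨ convolution-cong _+_ _*_ K (λ J _ → indicator-at P a uniqueP J) (λ i _ → indicator-at Q b uniqueQ i) ⟩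
    convℕ (λ J → ⟦ P a ⟧ * ⟦ a ≡ᵇ J ⟧) (λ i → ⟦ Q b ⟧ * ⟦ b ≡ᵇ i ⟧) K
      ≡⟨ convℕ-scale ⟦ P a ⟧ ⟦ Q b ⟧ _ _ K ⟩
    ⟦ P a ⟧ * ⟦ Q b ⟧ * convℕ (λ J → ⟦ a ≡ᵇ J ⟧) (λ i → ⟦ b ≡ᵇ i ⟧) K
      ≡⟨ cong (⟦ P a ⟧ * ⟦ Q b ⟧ *_) (convℕ-indicators a b K) ⟩
    ⟦ P a ⟧ * ⟦ Q b ⟧ * ⟦ a + b ≡ᵇ K ⟧
      ≡⟨ *-assoc ⟦ P a ⟧ _ _ ⟩
    ⟦ P a ⟧ * (⟦ Q b ⟧ * ⟦ a + b ≡ᵇ K ⟧)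
      ≡⟨ sym (trans (⟦∧⟧ (P a) _) (cong (⟦ P a ⟧ *_) (⟦∧⟧ (Q b) _))) ⟩
    ⟦ P a ∧ (Q b ∧ (a + b ≡ᵇ K)) ⟧ ∎
    where open ≡-Reasoning

  Σᵥ-convˡ : ∀ n (f : ℕ → Vec Bool n → ℕ) g K →
    Σᵥ n (λ v → convℕ (λ J → f J v) g K) ≡ convℕ (λ J → Σᵥ n (f J)) g K
  Σᵥ-convˡ n f g zero    = Σᵥ-scaleʳ n (g 0) (f 0)
  Σᵥ-convˡ n f g (suc K) =
    trans (Σᵥ-+ n _ _) (cong₂ _+_ (Σᵥ-convˡ n f (g ∘ suc) K) (Σᵥ-scaleʳ n (g 0) (f (suc K))))

  Σᵥ-convʳ : ∀ n f (g : ℕ → Vec Bool n → ℕ) K →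
    Σᵥ n (λ v → convℕ f (λ i → g i v) K) ≡ convℕ f (λ i → Σᵥ n (g i)) K
  Σᵥ-convʳ n f g zero    = Σᵥ-scale n (f 0) (g 0)
  Σᵥ-convʳ n f g (suc K) =
    trans (Σᵥ-+ n _ _) (cong₂ _+_ (Σᵥ-convʳ n f (g ∘ suc) K) (Σᵥ-scale n (f (suc K)) (g 0)))

  convℕ-cast : ∀ f g K → + convℕ f g K ≡ convolution ℤ._+_ ℤ._*_ (+_ ∘ f) (+_ ∘ g) K
  convℕ-cast f g zero    = pos-* (f 0) (g 0)
  convℕ-cast f g (suc K) =
    trans (pos-+ (convℕ f (g ∘ suc) K) _) (cong₂ ℤ._+_ (convℕ-cast f (g ∘ suc) K) (pos-* (f (suc K)) (g 0)))

-- Three Boolean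
-- scanners are defined by structural recursion, each proved to recognise a
-- positional condition:
--   line a b j w   : j members, all in the window [a, m − b), pairwise more
--                    than s apart  (a separated subset of a segment);
--   circle r j w   : j members, s-separated on the circle of circumference
--                    t + m whose last m positions are w, where t + r = s
--                    (t empty positions have been read already);
--   anchored J w   : J + 1 members including position 0, s-separated on the
--                    circle w.
-- Because the scanners are structurally recursive, the number of vectors they
-- accept satisfies simple recursions (`ScannerCounts`).
module Scanning (s : ℕ) where

  open import Data.Nat
    using (zero; suc; pred; _+_; _≤_; _<_; z≤n; s≤s; _≤ᵇ_; _≡ᵇ_)
  open import Data.Nat.Properties
    using (≤-pred; pred-mono-≤; +-suc; +-identityʳ; +-comm; ≤-refl; ≤-trans; n≮0; m≤m+n; m≤n+m;
           +-monoˡ-<; +-monoʳ-<; +-mono-≤; +-cancelˡ-<; module ≤-Reasoning;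
           ≤ᵇ⇒≤; ≤⇒≤ᵇ; ≡ᵇ⇒≡; ≡⇒≡ᵇ; suc-injective)
  open import Data.Bool using (Bool; true; false; _∧_; T)
  open import Data.Bool.Properties using (T-∧)
  open import Data.Vec using (Vec; []; _∷_)
  open import Data.Product using (_×_; _,_; proj₁; proj₂)
  open import Data.Empty using (⊥-elim)
  open import Function.Bundles using (_⇔_; mk⇔; Equivalence)
  open import Relation.Binary.PropositionalEquality
  open import Data.Nat.Tactic.RingSolver using (solve-∀)
  open Equivalence using (to; from)

  at : ∀ {m} → Vec Bool m → ℕ → Bool
  at []      _       = false
  at (b ∷ w) zero    = b
  at (b ∷ w) (suc p) = at w p

  infix 4 _∋_
  _∋_ : ∀ {m} → Vec Bool m → ℕ → Set
  w ∋ p = T (at w p)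

  size : ∀ {m} → Vec Bool m → ℕ
  size []          = 0
  size (true ∷ w)  = suc (size w)
  size (false ∷ w) = size w

  ∋⇒< : ∀ {m} (w : Vec Bool m) {p} → w ∋ p → p < m
  ∋⇒< (b ∷ w) {zero}  _   = s≤s z≤n
  ∋⇒< (b ∷ w) {suc p} w∋p = s≤s (∋⇒< w w∋p)

  Spaced : ∀ {m} → Vec Bool m → Set
  Spaced w = ∀ p q → p < q → w ∋ p → w ∋ q → s + p < q

  InWindow : ∀ {m} → ℕ → ℕ → Vec Bool m → Set
  InWindow {m} a b w = ∀ p → w ∋ p → a ≤ p × p + b < m

  SegmentSpaced : ∀ {m} → ℕ → ℕ → Vec Bool m → Set
  SegmentSpaced a b w = InWindow a b w × Spaced w

  -- Any two members are more than s apart also around a circle of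
  -- circumference N (the gap from q forward to p is N − q + p − 1).
  CircSpaced : ∀ {m} → ℕ → Vec Bool m → Set
  CircSpaced N w = ∀ p q → p < q → w ∋ p → w ∋ q → s + p < q × q + s < N + p

  -- `line a b j` skips the first a positions, and a member at position p
  -- forbids the next s positions and needs b positions after it.
  line : ∀ {m} → ℕ → ℕ → ℕ → Vec Bool m → Bool
  line         a       b j       []          = j ≡ᵇ 0
  line         a       b j       (false ∷ w) = line (pred a) b j w
  line         zero    b zero    (true ∷ w)  = false
  line {suc m} zero    b (suc j) (true ∷ w)  = (b ≤ᵇ m) ∧ line s b j w
  line         (suc a) b j       (true ∷ w)  = false

  -- `circle r` reads an empty position with `afterGap r`: while r > 0 the
  -- wrap-around gap may still be too short, afterwards it cannot be.
  circle   : ∀ {m} → ℕ → ℕ → Vec Bool m → Bool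
  afterGap : ∀ {m} → ℕ → ℕ → Vec Bool m → Bool

  circle r j       []          = j ≡ᵇ 0
  circle r j       (false ∷ w) = afterGap r j w
  circle r zero    (true ∷ w)  = false
  circle r (suc j) (true ∷ w)  = line s r j w

  afterGap zero    j w = line 0 0 j w
  afterGap (suc r) j w = circle r j w

  -- A circle starting with a member is a segment without its first and last
  -- s positions.
  anchored : ∀ {m} → ℕ → Vec Bool m → Bool
  anchored J []          = false
  anchored J (false ∷ w) = false
  anchored J (true ∷ w)  = line s s J w

  near-shift : ∀ {p q} → s + p < q → s + suc p < suc q
  near-shift {p} {q} s+p<q = subst (_< suc q) (sym (+-suc s p)) (s≤s s+p<q)

  near-shift⁻ : ∀ {p q} → s + suc p < suc q → s + p < q
  near-shift⁻ {p} {q} h = ≤-pred (subst (_< suc q) (+-suc s p) h)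

  wrap-shift : ∀ {N p q} → q + s < N + p → suc q + s < N + suc p
  wrap-shift {N} {p} {q} h = subst (suc q + s <_) (sym (+-suc N p)) (s≤s h)

  wrap-shift⁻ : ∀ {N p q} → suc q + s < N + suc p → q + s < N + p
  wrap-shift⁻ {N} {p} {q} h = ≤-pred (subst (suc q + s <_) (+-suc N p) h)

  Spaced-tail : ∀ {m} x (w : Vec Bool m) → Spaced (x ∷ w) → Spaced w
  Spaced-tail x w S p q p<q w∋p w∋q = near-shift⁻ (S (suc p) (suc q) (s≤s p<q) w∋p w∋q)

  Spaced-false : ∀ {m} (w : Vec Bool m) → Spaced w → Spaced (false ∷ w)
  Spaced-false w S (suc p) (suc q) (s≤s p<q) w∋p w∋q = near-shift (S p q p<q w∋p w∋q)

  Spaced-true : ∀ {m} (w : Vec Bool m) → Spaced w → (∀ q → w ∋ q → s ≤ q) → Spaced (true ∷ w)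
  Spaced-true w S low zero    (suc q) _         _   w∋q =
    subst (_< suc q) (sym (+-identityʳ s)) (s≤s (low q w∋q))
  Spaced-true w S low (suc p) (suc q) (s≤s p<q) w∋p w∋q = near-shift (S p q p<q w∋p w∋q)

  Spaced-true⁻ : ∀ {m} (w : Vec Bool m) → Spaced (true ∷ w) → ∀ q → w ∋ q → s ≤ q
  Spaced-true⁻ w S q w∋q = ≤-pred (subst (_< suc q) (+-identityʳ s) (S 0 (suc q) (s≤s z≤n) _ w∋q))

  CircSpaced-tail : ∀ {m} N x (w : Vec Bool m) → CircSpaced N (x ∷ w) → CircSpaced N w
  CircSpaced-tail N x w C p q p<q w∋p w∋q =
    let c = C (suc p) (suc q) (s≤s p<q) w∋p w∋q in near-shift⁻ (proj₁ c) , wrap-shift⁻ (proj₂ c)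

  CircSpaced-false : ∀ {m} N (w : Vec Bool m) → CircSpaced N w → CircSpaced N (false ∷ w)
  CircSpaced-false N w C (suc p) (suc q) (s≤s p<q) w∋p w∋q =
    let c = C p q p<q w∋p w∋q in near-shift (proj₁ c) , wrap-shift (proj₂ c)

  window-false : ∀ {m} a b (w : Vec Bool m) → InWindow (pred a) b w → InWindow a b (false ∷ w)
  window-false a b w W (suc p) w∋p = let (a≤p , p<) = W p w∋p in ≤-trans (pred-≤ a) (s≤s a≤p) , s≤s p<
    where
    pred-≤ : ∀ a → a ≤ suc (pred a)
    pred-≤ zero    = z≤n
    pred-≤ (suc a) = ≤-refl

  window-false⁻ : ∀ {m} a b (w : Vec Bool m) → InWindow a b (false ∷ w) → InWindow (pred a) b w
  window-false⁻ a b w W p w∋p = let (a≤p , p<) = W (suc p) w∋p in pred-mono-≤ a≤p , ≤-pred p<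

  line-correct : ∀ {m} a b j (w : Vec Bool m) → T (line a b j w) ⇔ (SegmentSpaced a b w × size w ≡ j)
  line-correct a b j [] =
    mk⇔ (λ h → ((λ _ ()) , (λ _ _ _ ())) , sym (≡ᵇ⇒≡ j 0 h)) (λ (_ , e) → ≡⇒≡ᵇ j 0 (sym e))
  line-correct a b j (false ∷ w) = mk⇔
    (λ h → let ((W , S) , e) = to IH h in (window-false a b w W , Spaced-false w S) , e)
    (λ ((W , S) , e) → from IH ((window-false⁻ a b w W , Spaced-tail false w S) , e))
    where IH = line-correct (pred a) b j w
  line-correct zero b zero (true ∷ w) = mk⇔ (λ ()) (λ { (_ , ()) })
  line-correct {suc m} zero b (suc j) (true ∷ w) = mk⇔
    (λ h → let (b≤m , h′) = to T-∧ h
               ((W , S) , e) = to IH h′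
           in (window W (≤ᵇ⇒≤ b m b≤m) , Spaced-true w S (λ q w∋q → proj₁ (W q w∋q))) , cong suc e)
    (λ ((W , S) , e) → from T-∧ (≤⇒≤ᵇ (≤-pred (proj₂ (W 0 _))) ,
                                from IH ((window⁻ W S , Spaced-tail true w S) , suc-injective e)))
    where
    IH = line-correct s b j w
    window : InWindow s b w → b ≤ m → InWindow 0 b (true ∷ w)
    window W b≤m zero    _   = z≤n , s≤s b≤m
    window W b≤m (suc p) w∋p = z≤n , s≤s (proj₂ (W p w∋p))
    window⁻ : InWindow 0 b (true ∷ w) → Spaced (true ∷ w) → InWindow s b w
    window⁻ W S q w∋q = Spaced-true⁻ w S q w∋q , ≤-pred (proj₂ (W (suc q) w∋q))
  line-correct (suc a) b j (true ∷ w) = mk⇔ (λ ()) (λ ((W , _) , _) → ⊥-elim (n≮0 (proj₁ (W 0 _))))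

  circle-correct : ∀ {m} t r j (w : Vec Bool m) → t + r ≡ s →
    T (circle r j w) ⇔ (CircSpaced (t + m) w × size w ≡ j)
  circle-correct t r j [] _ =
    mk⇔ (λ h → (λ _ _ _ ()) , sym (≡ᵇ⇒≡ j 0 h)) (λ (_ , e) → ≡⇒≡ᵇ j 0 (sym e))
  circle-correct {suc m} t zero j (false ∷ w) t≡s = mk⇔
    (λ h → let ((_ , S) , e) = to (line-correct 0 0 j w) h in
           CircSpaced-false (t + suc m) w (λ p q p<q w∋p w∋q → S p q p<q w∋p w∋q , far (∋⇒< w w∋q)) , e)
    (λ (C , e) → from (line-correct 0 0 j w)
      (((λ p w∋p → z≤n , subst (_< m) (sym (+-identityʳ p)) (∋⇒< w w∋p)) ,
        (λ p q p<q w∋p w∋q → proj₁ (CircSpaced-tail _ false w C p q p<q w∋p w∋q))) , e))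
    where
    -- after s empty positions the wrap-around gap is automatically large
    far : ∀ {p q} → q < m → q + s < t + suc m + p
    far {p} {q} q<m = begin-strict
      q + s          ≡⟨ cong (q +_) (sym (trans (sym (+-identityʳ t)) t≡s)) ⟩
      q + t          <⟨ +-monoˡ-< t q<m ⟩
      m + t          ≤⟨ m≤n+m (m + t) 1 ⟩
      suc m + t      ≡⟨ +-comm (suc m) t ⟩
      t + suc m      ≤⟨ m≤m+n (t + suc m) p ⟩
      t + suc m + p  ∎
      where open ≤-Reasoning
  circle-correct {suc m} t (suc r) j (false ∷ w) t+r≡s = mk⇔
    (λ h → let (C , e) = to IH h in
           CircSpaced-false (t + suc m) w (subst (λ N → CircSpaced N w) (sym (+-suc t m)) C) , e)
    (λ (C , e) → from IH (subst (λ N → CircSpaced N w) (+-suc t m) (CircSpaced-tail _ false w C) , e))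
    where IH = circle-correct (suc t) r j w (trans (sym (+-suc t r)) t+r≡s)
  circle-correct t r zero (true ∷ w) _ = mk⇔ (λ ()) (λ { (_ , ()) })
  circle-correct {suc m} t r (suc j) (true ∷ w) t+r≡s = mk⇔
    (λ h → let ((W , S) , e) = to (line-correct s r j w) h in circ W S , cong suc e)
    (λ (C , e) → from (line-correct s r j w) ((window C , Spaced-tail true w (near C)) , suc-injective e))
    where
    near : CircSpaced (t + suc m) (true ∷ w) → Spaced (true ∷ w)
    near C p q p<q w∋p w∋q = proj₁ (C p q p<q w∋p w∋q)
    reassoc : ∀ q t r → suc q + (t + r) ≡ t + suc (q + r)
    reassoc = solve-∀
    reassoc′ : ∀ t m p → suc t + suc (m + p) ≡ t + suc m + suc p
    reassoc′ = solve-∀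
    -- the gap from a last member q back round to position 0
    last : ∀ {q} → q + r < m → suc q + s < t + suc m + 0
    last {q} q+r<m = begin-strict
      suc q + s              ≡⟨ cong (suc q +_) (sym t+r≡s) ⟩
      suc q + (t + r)        ≡⟨ reassoc q t r ⟩
      t + suc (q + r)        <⟨ +-monoʳ-< t (s≤s q+r<m) ⟩
      t + suc m              ≡⟨ sym (+-identityʳ _) ⟩
      t + suc m + 0          ∎
      where open ≤-Reasoning
    last⁻ : ∀ {q} → suc q + s < t + suc m + 0 → q + r < m
    last⁻ {q} h = ≤-pred (+-cancelˡ-< t (suc (q + r)) (suc m) (begin-strict
      t + suc (q + r)        ≡⟨ sym (reassoc q t r) ⟩
      suc q + (t + r)        ≡⟨ cong (suc q +_) t+r≡s ⟩
      suc q + s              <⟨ h ⟩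
      t + suc m + 0          ≡⟨ +-identityʳ _ ⟩
      t + suc m              ∎))
      where open ≤-Reasoning
    -- two members after the first one are far apart round the circle
    inner : ∀ {p q} → q < m → s ≤ p → suc q + s < t + suc m + suc p
    inner {p} {q} q<m s≤p = begin-strict
      suc q + s              <⟨ s≤s (+-mono-≤ q<m s≤p) ⟩
      suc (m + p)            ≤⟨ m≤n+m (suc (m + p)) (suc t) ⟩
      suc t + suc (m + p)    ≡⟨ reassoc′ t m p ⟩
      t + suc m + suc p      ∎
      where open ≤-Reasoning
    circ : InWindow s r w → Spaced w → CircSpaced (t + suc m) (true ∷ w)
    circ W S zero    (suc q) _         _   w∋q = let (s≤q , q+r<m) = W q w∋q in
      subst (_< suc q) (sym (+-identityʳ s)) (s≤s s≤q) , last q+r<m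
    circ W S (suc p) (suc q) (s≤s p<q) w∋p w∋q =
      near-shift (S p q p<q w∋p w∋q) , inner (∋⇒< w w∋q) (proj₁ (W p w∋p))
    window : CircSpaced (t + suc m) (true ∷ w) → InWindow s r w
    window C q w∋q = Spaced-true⁻ w (near C) q w∋q , last⁻ (proj₂ (C 0 (suc q) (s≤s z≤n) _ w∋q))

  anchored-correct : ∀ {n} J (w : Vec Bool n) →
    T (anchored J w) ⇔ (CircSpaced n w × w ∋ 0 × size w ≡ suc J)
  anchored-correct J []          = mk⇔ (λ ()) (λ { (_ , () , _) })
  anchored-correct J (false ∷ w) = mk⇔ (λ ()) (λ { (_ , () , _) })
  anchored-correct J (true ∷ w)  = mk⇔
    (λ h → let (C , e) = to circ-view h in C , _ , e)
    (λ (C , _ , e) → from circ-view (C , e))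
    where
    circ-view = circle-correct 0 s (suc J) (true ∷ w) refl

module ScannerCounts (s : ℕ) where

  open import Data.Nat
    using (zero; suc; _+_; _*_; _∸_; _≤_; _≤ᵇ_; _≤?_)
  open import Data.Nat.Properties
    using (+-identityʳ; +-suc; *-zeroʳ; *-suc; +-assoc; 0∸n≡0; +-∸-assoc; m≤n⇒m∸n≡0;
           [m+n]∸[m+o]≡n∸o; ≤-trans; m≤m+n; m≤m*n; ≰⇒>; <⇒≤; <⇒≱; ≤⇒≤ᵇ; ≤ᵇ⇒≤)
  open import Data.Nat.Tactic.RingSolver using (solve-∀)
  open import Data.Bool using (_∧_)
  open import Data.Empty using (⊥-elim)
  open import Relation.Nullary using (¬_; yes; no)
  open import Function using (_∘_)
  open import Relation.Binary.PropositionalEquality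
  open Binomial
  open BooleanVectors
  open Scanning s

  segmentCount : ℕ → ℕ → ℕ → ℕ → ℕ
  segmentCount a b zero    m = 1
  segmentCount a b (suc j) m = (m ∸ (a + b + s * j)) choose suc j

  -- The step of the induction in `line-count`: adding a first position to a
  -- segment either leaves it empty or makes it a member.
  first-position-step : ∀ b j m →
    ⟦ b ≤ᵇ m ⟧ * ((m ∸ (b + s * j)) choose j) + (m ∸ (b + s * j)) choose suc j
      ≡ (suc m ∸ (b + s * j)) choose suc j
  first-position-step b j m with b + s * j ≤? m
  ... | yes X≤m rewrite ⟦⟧-true (≤⇒≤ᵇ (≤-trans (m≤m+n b (s * j)) X≤m)) | +-∸-assoc 1 X≤m =
    cong (_+ (m ∸ (b + s * j)) choose suc j) (+-identityʳ _)
  ... | no X≰m rewrite m≤n⇒m∸n≡0 (<⇒≤ (≰⇒> X≰m)) | m≤n⇒m∸n≡0 (≰⇒> X≰m) = vanish j X≰m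
    where
    vanish : ∀ j → ¬ (b + s * j ≤ m) → ⟦ b ≤ᵇ m ⟧ * 0 choose j + 0 ≡ 0
    vanish zero    X≰m = begin
      ⟦ b ≤ᵇ m ⟧ * 1 + 0 ≡⟨ cong (λ x → x * 1 + 0) (⟦⟧-false (X≰m ∘ widen ∘ ≤ᵇ⇒≤ b m)) ⟩
      0                  ∎
      where
      open ≡-Reasoning
      widen : b ≤ m → b + s * 0 ≤ m
      widen = subst (_≤ m) (sym (trans (cong (b +_) (*-zeroʳ s)) (+-identityʳ b)))
    vanish (suc j) _   = trans (+-identityʳ _) (*-zeroʳ ⟦ b ≤ᵇ m ⟧)

  line-count : ∀ m a b j → Σᵥ m (λ w → ⟦ line a b j w ⟧) ≡ segmentCount a b j m
  line-count zero a b zero    = refl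
  line-count zero a b (suc j) = cong (_choose suc j) (sym (0∸n≡0 (a + b + s * j)))
  line-count (suc m) (suc a) b j =
    trans (cong₂ _+_ (Σᵥ-zero m) (line-count m a b j)) (shifted j)
    where
    shifted : ∀ j → segmentCount a b j m ≡ segmentCount (suc a) b j (suc m)
    shifted zero    = refl
    shifted (suc j) = refl
  line-count (suc m) zero b zero = cong₂ _+_ (Σᵥ-zero m) (line-count m 0 b 0)
  line-count (suc m) zero b (suc j) = begin
    Σᵥ m (λ w → ⟦ (b ≤ᵇ m) ∧ line s b j w ⟧) + Σᵥ m (λ w → ⟦ line 0 b (suc j) w ⟧)
      ≡⟨ cong₂ _+_ (trans (Σᵥ-cong m (λ w → ⟦∧⟧ (b ≤ᵇ m) (line s b j w))) (Σᵥ-scale m ⟦ b ≤ᵇ m ⟧ _))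
                   (line-count m 0 b (suc j)) ⟩
    ⟦ b ≤ᵇ m ⟧ * Σᵥ m (λ w → ⟦ line s b j w ⟧) + (m ∸ (b + s * j)) choose suc j
      ≡⟨ cong (λ c → ⟦ b ≤ᵇ m ⟧ * c + (m ∸ (b + s * j)) choose suc j) (trans (line-count m s b j) (segment j)) ⟩
    ⟦ b ≤ᵇ m ⟧ * ((m ∸ (b + s * j)) choose j) + (m ∸ (b + s * j)) choose suc j
      ≡⟨ first-position-step b j m ⟩
    (suc m ∸ (b + s * j)) choose suc j ∎
    where
    open ≡-Reasoning
    regroup : ∀ s b j → s + b + s * j ≡ b + s * suc j
    regroup = solve-∀
    segment : ∀ j → segmentCount s b j m ≡ (m ∸ (b + s * j)) choose j
    segment zero    = refl
    segment (suc j) = cong (λ X → (m ∸ X) choose suc j) (regroup s b j)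

  drop-prefix : ∀ t m X → t + suc m ∸ suc (t + X) ≡ m ∸ X
  drop-prefix t m X = trans (cong (_∸ suc (t + X)) (+-suc t m)) ([m+n]∸[m+o]≡n∸o t m X)

  -- A member at the first position of the circle leaves a segment for the
  -- remaining i members.
  first-member : ∀ m t r i → t + r ≡ s → segmentCount s r i m ≡ (t + suc m ∸ suc (s * suc i)) choose i
  first-member m t r zero    _     = refl
  first-member m t r (suc i) t+r≡s = cong (_choose suc i) (sym (begin
    t + suc m ∸ suc (s * suc (suc i))  ≡⟨ cong (λ X → t + suc m ∸ suc X) split ⟩
    t + suc m ∸ suc (t + (s + r + s * i)) ≡⟨ drop-prefix t m _ ⟩
    m ∸ (s + r + s * i) ∎))
    where
    open ≡-Reasoning
    regroup : ∀ t r s i → t + r + s * suc i ≡ t + (s + r + s * i)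
    regroup = solve-∀
    split : s * suc (suc i) ≡ t + (s + r + s * i)
    split = trans (*-suc s (suc i)) (trans (cong (_+ s * suc i) (sym t+r≡s)) (regroup t r s i))

  circle-count-empty : ∀ m r → Σᵥ m (λ w → ⟦ circle r 0 w ⟧) ≡ 1
  circle-count-empty zero    r       = refl
  circle-count-empty (suc m) zero    = cong₂ _+_ (Σᵥ-zero m) (line-count m 0 0 0)
  circle-count-empty (suc m) (suc r) = cong₂ _+_ (Σᵥ-zero m) (circle-count-empty m r)

  circle-count : ∀ m t r i → t + r ≡ s → suc (s * suc i) ≤ t + m →
    Σᵥ m (λ w → ⟦ circle r (suc i) w ⟧)
      ≡ suc r * ((t + m ∸ suc (s * suc i)) choose i) + (t + m ∸ suc (s * suc i)) choose suc i
  circle-count zero t r i t+r≡s room =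
    ⊥-elim (<⇒≱ room (≤-trans (subst (_≤ s) (sym (+-identityʳ t)) t≤s) (m≤m*n s (suc i))))
    where
    t≤s : t ≤ s
    t≤s = subst (t ≤_) t+r≡s (m≤m+n t r)
  circle-count (suc m) t zero i t≡s room = begin
    Σᵥ m (λ w → ⟦ line s 0 i w ⟧) + Σᵥ m (λ w → ⟦ line 0 0 (suc i) w ⟧)
      ≡⟨ cong₂ _+_ (trans (line-count m s 0 i) (first-member m t 0 i t≡s)) (line-count m 0 0 (suc i)) ⟩
    X choose i + (m ∸ s * i) choose suc i
      ≡⟨ cong₂ (λ a b → a + b choose suc i) (sym (+-identityʳ (X choose i))) (sym no-wrap) ⟩
    1 * X choose i + X choose suc i ∎
    where
    open ≡-Reasoning
    X = t + suc m ∸ suc (s * suc i)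
    -- here t = s, so the wrap-around condition is automatic
    no-wrap : X ≡ m ∸ s * i
    no-wrap = trans (cong (λ Y → t + suc m ∸ suc Y)
                      (trans (*-suc s i) (cong (_+ s * i) (sym (trans (sym (+-identityʳ t)) t≡s)))))
                    (drop-prefix t m (s * i))
  circle-count (suc m) t (suc r) i t+r≡s room = begin
    Σᵥ m (λ w → ⟦ line s (suc r) i w ⟧) + Σᵥ m (λ w → ⟦ circle r (suc i) w ⟧)
      ≡⟨ cong₂ _+_ (trans (line-count m s (suc r) i) (first-member m t (suc r) i t+r≡s))
                   (circle-count m (suc t) r i t′+r≡s (subst (suc (s * suc i) ≤_) (+-suc t m) room)) ⟩
    X choose i + (suc r * (X′ choose i) + X′ choose suc i)
      ≡⟨ cong (λ Y → X choose i + (suc r * (Y choose i) + Y choose suc i)) X′≡X ⟩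
    X choose i + (suc r * (X choose i) + X choose suc i)
      ≡⟨ sym (+-assoc (X choose i) _ _) ⟩
    suc (suc r) * X choose i + X choose suc i ∎
    where
    open ≡-Reasoning
    X  = t + suc m ∸ suc (s * suc i)
    X′ = suc t + m ∸ suc (s * suc i)
    X′≡X : X′ ≡ X
    X′≡X = cong (_∸ suc (s * suc i)) (sym (+-suc t m))
    t′+r≡s : suc t + r ≡ s
    t′+r≡s = trans (sym (+-suc t r)) t+r≡s

  anchored-count : ∀ m J → Σᵥ (suc m) (λ w → ⟦ anchored J w ⟧) ≡ (suc m ∸ suc (s * suc J)) choose J
  anchored-count m J = begin
    Σᵥ m (λ w → ⟦ line s s J w ⟧) + Σᵥ m (λ _ → 0)
      ≡⟨ cong₂ _+_ (trans (line-count m s s J) (first-member m 0 s J refl)) (Σᵥ-zero m) ⟩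
    (suc m ∸ suc (s * suc J)) choose J + 0
      ≡⟨ +-identityʳ _ ⟩
    (suc m ∸ suc (s * suc J)) choose J ∎
    where open ≡-Reasoning

module CircleSeparation (s : ℕ) where

  open import Data.Nat using (suc; _+_; _∸_; _≤_; _<_; s≤s; ∣_-_∣)
  open import Data.Nat.Properties
    using (≤-pred; <⇒≤; ≤-trans; m∸n≤m; m<n⇒0<n∸m; m+n≤o⇒m≤o∸n; m≤o∸n⇒m+n≤o; m∸n+n≡m;
           +-assoc; +-comm; +-monoˡ-≤; +-cancelʳ-≤; <-cmp; <-irrefl; m≤n⇒∣m-n∣≡n∸m; ∣-∣-comm)
  open import Data.Bool using (true; false)
  open import Data.Vec using (_∷_; []; here; there)
  open import Data.Fin using (toℕ; fromℕ<) renaming (zero to fzero; suc to fsuc)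
  open import Data.Fin.Properties using (toℕ<n; toℕ-fromℕ<; toℕ-injective)
  open import Data.Fin.Subset using (Subset; _∈_; ∣_∣)
  open import Data.Product using (_×_; _,_)
  open import Data.Empty using (⊥-elim)
  open import Relation.Nullary using (¬_)
  open import Relation.Binary.Definitions using (tri<; tri≈; tri>)
  open import Function.Bundles using (_⇔_; mk⇔; Equivalence)
  open import Relation.Binary.PropositionalEquality
  open Equivalence using (to; from)
  open import Defs using (SeparatedOnCircle)
  open Scanning s

  ∈⇒∋ : ∀ {n} (A : Subset n) i → i ∈ A → A ∋ toℕ i
  ∈⇒∋ (x ∷ A) fzero     here      = _
  ∈⇒∋ (x ∷ A) (fsuc i) (there i∈A) = ∈⇒∋ A i i∈A

  ∋⇒∈ : ∀ {n} (A : Subset n) i → A ∋ toℕ i → i ∈ A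
  ∋⇒∈ (true ∷ A) fzero    _   = here
  ∋⇒∈ (x ∷ A)    (fsuc i) A∋i = there (∋⇒∈ A i A∋i)

  size≡∣∣ : ∀ {n} (A : Subset n) → size A ≡ ∣ A ∣
  size≡∣∣ []          = refl
  size≡∣∣ (true ∷ A)  = cong suc (size≡∣∣ A)
  size≡∣∣ (false ∷ A) = size≡∣∣ A

  gap-conditions : ∀ {n p q} → p < q → q < n →
    (s ≤ (q ∸ p) ∸ 1 × s ≤ n ∸ (q ∸ p) ∸ 1) ⇔ (s + p < q × q + s < n + p)
  gap-conditions {n} {p} {q} p<q q<n = mk⇔
    (λ (inner , outer) → to near (to (≤∸1⇔< (m<n⇒0<n∸m p<q)) inner) ,
                         to far (to (≤∸1⇔< (m<n⇒0<n∸m d<n)) outer))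
    (λ (inner , outer) → from (≤∸1⇔< (m<n⇒0<n∸m p<q)) (from near inner) ,
                         from (≤∸1⇔< (m<n⇒0<n∸m d<n)) (from far outer))
    where
    p≤q = <⇒≤ p<q
    d<n : q ∸ p < n
    d<n = ≤-trans (s≤s (m∸n≤m q p)) q<n
    ≤∸1⇔< : ∀ {z} → 0 < z → (s ≤ z ∸ 1) ⇔ (s < z)
    ≤∸1⇔< {suc z} _ = mk⇔ s≤s ≤-pred
    near : (s < q ∸ p) ⇔ (s + p < q)
    near = mk⇔ (m≤o∸n⇒m+n≤o (suc s) p≤q) (m+n≤o⇒m≤o∸n (suc s))
    reshape : suc s + (q ∸ p) + p ≡ suc (q + s)
    reshape = trans (+-assoc (suc s) (q ∸ p) p) (cong suc (trans (cong (s +_) (m∸n+n≡m p≤q)) (+-comm s q)))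
    far : (s < n ∸ (q ∸ p)) ⇔ (q + s < n + p)
    far = mk⇔ (λ h → subst (_≤ n + p) reshape (+-monoˡ-≤ p (m≤o∸n⇒m+n≤o (suc s) (<⇒≤ d<n) h)))
              (λ h → m+n≤o⇒m≤o∸n (suc s) (+-cancelʳ-≤ p _ _ (subst (_≤ n + p) (sym reshape) h)))

  separated⇔circSpaced : ∀ {n} (A : Subset n) → SeparatedOnCircle s n A ⇔ CircSpaced n A
  separated⇔circSpaced {n} A = mk⇔ circSpaced separated
    where
    Gaps : ℕ → Set
    Gaps d = s ≤ d ∸ 1 × s ≤ n ∸ d ∸ 1
    circSpaced : SeparatedOnCircle s n A → CircSpaced n A
    circSpaced S p q p<q A∋p A∋q = to (gap-conditions p<q q<n) (subst Gaps distance (S i j i∈A j∈A i≢j))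
      where
      q<n = ∋⇒< A A∋q
      p<n = ≤-trans (s≤s (<⇒≤ p<q)) q<n
      i = fromℕ< p<n
      j = fromℕ< q<n
      i∈A = ∋⇒∈ A i (subst (A ∋_) (sym (toℕ-fromℕ< p<n)) A∋p)
      j∈A = ∋⇒∈ A j (subst (A ∋_) (sym (toℕ-fromℕ< q<n)) A∋q)
      i≢j : ¬ i ≡ j
      i≢j i≡j = <-irrefl (trans (sym (toℕ-fromℕ< p<n)) (trans (cong toℕ i≡j) (toℕ-fromℕ< q<n))) p<q
      distance : ∣ toℕ i - toℕ j ∣ ≡ q ∸ p
      distance = trans (cong₂ ∣_-_∣ (toℕ-fromℕ< p<n) (toℕ-fromℕ< q<n)) (m≤n⇒∣m-n∣≡n∸m (<⇒≤ p<q))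
    ordered : CircSpaced n A → ∀ i j → toℕ i < toℕ j → i ∈ A → j ∈ A → Gaps ∣ toℕ i - toℕ j ∣
    ordered C i j i<j i∈A j∈A = subst Gaps (sym (m≤n⇒∣m-n∣≡n∸m (<⇒≤ i<j)))
      (from (gap-conditions i<j (toℕ<n j)) (C (toℕ i) (toℕ j) i<j (∈⇒∋ A i i∈A) (∈⇒∋ A j j∈A)))
    separated : CircSpaced n A → SeparatedOnCircle s n A
    separated C i j i∈A j∈A i≢j with <-cmp (toℕ i) (toℕ j)
    ... | tri< i<j _ _ = ordered C i j i<j i∈A j∈A
    ... | tri≈ _ i≡j _ = ⊥-elim (i≢j (toℕ-injective i≡j))
    ... | tri> _ _ j<i = subst Gaps (∣-∣-comm (toℕ j) (toℕ i)) (ordered C j i j<i j∈A i∈A)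

-- The scanner counts are the coefficients of the Hagen–Rothe identity:
-- anchored sets give C(u − sJ, J) with u = n₁ − 1 − s, and separated sets on
-- the second circle give R(n₂, i).  Hence their convolution is
-- C(u + n₂ − sK, K) = C(n₁ + n₂ − s(K+1) − 1, K).
module ScannerCoefficients (s : ℕ) where

  open import Data.Nat as ℕ using (zero; suc; _≤_; _<_; s≤s)
  open import Data.Nat.Properties
    using (≤-trans; +-monoˡ-≤; *-monoʳ-≤; *-suc; +-comm; ∸-+-assoc; m≤m+n)
  open import Data.Nat.Combinatorics using (_C_)
  open import Data.Integer using (+_; _+_; _-_; _*_)
  open import Data.Integer.Properties using (pos-+; pos-*; m-n≡m⊖n; ⊖-≥; +-injective)
  open import Data.Integer.Tactic.RingSolver using (solve-∀)
  open import Function using (_∘′_)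
  open import Relation.Binary.PropositionalEquality
  open Binomial
  open Convolution
  open IntegerBinomial
  open HagenRothe s
  open BooleanVectors
  open NaturalConvolution
  open Scanning s
  open ScannerCounts s

  one-plus-gaps : ∀ J → + 1 + S * + suc J ≡ + suc (s ℕ.* suc J)
  one-plus-gaps J = sym (trans (pos-+ 1 (s ℕ.* suc J)) (cong (λ x → + 1 + x) (pos-* s (suc J))))

  pos-∸ : ∀ {m n} → m ≤ n → + n - + m ≡ + (n ℕ.∸ m)
  pos-∸ {m} {n} m≤n = trans (m-n≡m⊖n n m) (⊖-≥ m≤n)

  anchored-binomial : ∀ m₁ J → suc (s ℕ.* suc J) ≤ suc m₁ →
    + Σᵥ (suc m₁) (λ A → ⟦ anchored J A ⟧) ≡ binomℤ (+ suc m₁ - (+ 1 + S) - S * + J) J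
  anchored-binomial m₁ J room = trans (cong +_ (anchored-count m₁ J)) (cong (λ z → binomℤ z J) (sym (begin
    + suc m₁ - (+ 1 + S) - S * + J    ≡⟨ regroup (+ suc m₁) S (+ J) ⟩
    + suc m₁ - (+ 1 + S * + suc J)    ≡⟨ cong (λ x → + suc m₁ - x) (one-plus-gaps J) ⟩
    + suc m₁ - + suc (s ℕ.* suc J)    ≡⟨ pos-∸ room ⟩
    + (suc m₁ ℕ.∸ suc (s ℕ.* suc J))  ∎)))
    where
    open ≡-Reasoning
    regroup : ∀ n S J → n - (+ 1 + S) - S * J ≡ n - (+ 1 + S * (+ 1 + J))
    regroup = solve-∀

  circle-rothe : ∀ n₂ i → s ℕ.* i < n₂ → + Σᵥ n₂ (λ B → ⟦ circle s i B ⟧) ≡ rothe (+ n₂) i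
  circle-rothe n₂ zero    _    = cong +_ (circle-count-empty n₂ s)
  circle-rothe n₂ (suc i) room = begin
    + Σᵥ n₂ (λ B → ⟦ circle s (suc i) B ⟧)
      ≡⟨ cong +_ (circle-count n₂ 0 s i refl room) ⟩
    + (suc s ℕ.* (X choose i) ℕ.+ X choose suc i)
      ≡⟨ trans (pos-+ (suc s ℕ.* (X choose i)) _) (cong (_+ + (X choose suc i)) (pos-* (suc s) (X choose i))) ⟩
    (+ 1 + S) * binomℤ (+ X) i + binomℤ (+ X) (suc i)
      ≡⟨ cong (λ z → (+ 1 + S) * binomℤ z i + binomℤ z (suc i)) (sym X≡) ⟩
    rothe (+ n₂) (suc i) ∎
    where
    open ≡-Reasoning
    X = n₂ ℕ.∸ suc (s ℕ.* suc i)
    X≡ : + n₂ - (+ 1 + S * + suc i) ≡ + X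
    X≡ = trans (cong (λ x → + n₂ - x) (one-plus-gaps i)) (pos-∸ room)

  scanner-convolution : ∀ K m₁ n₂ → 1 ≤ s → suc (s ℕ.* suc K) ≤ suc m₁ → s ℕ.* suc K ≤ n₂ →
    convℕ (λ J → Σᵥ (suc m₁) (λ A → ⟦ anchored J A ⟧)) (λ i → Σᵥ n₂ (λ B → ⟦ circle s i B ⟧)) K
      ≡ (suc m₁ ℕ.+ n₂ ℕ.∸ s ℕ.* suc K ℕ.∸ 1) C K
  scanner-convolution K m₁ n₂ 1≤s room₁ room₂ = +-injective (begin
    + convℕ anchoredCounts circleCounts K
      ≡⟨ convℕ-cast anchoredCounts circleCounts K ⟩
    conv (+_ ∘′ anchoredCounts) (+_ ∘′ circleCounts) K
      ≡⟨ convolution-cong _+_ _*_ K (λ J J≤K → anchored-binomial m₁ J (room₁-at J≤K))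
                                    (λ i i≤K → circle-rothe n₂ i (room₂-at i≤K)) ⟩
    conv (λ J → binomℤ (u - S * + J) J) (rothe (+ n₂)) K
      ≡⟨ hagen-rothe K u (+ n₂) ⟩
    binomℤ (u + + n₂ - S * + K) K
      ≡⟨ cong (λ z → binomℤ z K) total ⟩
    + (X choose K)
      ≡⟨ cong +_ (choose≡C X K) ⟩
    + (X C K) ∎)
    where
    open ≡-Reasoning
    anchoredCounts circleCounts : ℕ → ℕ
    anchoredCounts J = Σᵥ (suc m₁) (λ A → ⟦ anchored J A ⟧)
    circleCounts i = Σᵥ n₂ (λ B → ⟦ circle s i B ⟧)
    u = + suc m₁ - (+ 1 + S)
    X = suc m₁ ℕ.+ n₂ ℕ.∸ s ℕ.* suc K ℕ.∸ 1
    room₁-at : ∀ {J} → J ≤ K → suc (s ℕ.* suc J) ≤ suc m₁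
    room₁-at J≤K = ≤-trans (s≤s (*-monoʳ-≤ s (s≤s J≤K))) room₁
    room₂-at : ∀ {i} → i ≤ K → s ℕ.* i < n₂
    room₂-at {i} i≤K = ≤-trans (s≤s (*-monoʳ-≤ s i≤K))
                               (≤-trans (+-monoˡ-≤ (s ℕ.* K) 1≤s) (subst (_≤ n₂) (*-suc s K) room₂))
    regroup : ∀ n₁ n₂ S K → n₁ - (+ 1 + S) + n₂ - S * K ≡ (n₁ + n₂) - (+ 1 + S * (+ 1 + K))
    regroup = solve-∀
    total : u + + n₂ - S * + K ≡ + X
    total = begin
      u + + n₂ - S * + K                           ≡⟨ regroup (+ suc m₁) (+ n₂) S (+ K) ⟩
      (+ suc m₁ + + n₂) - (+ 1 + S * + suc K)      ≡⟨ cong₂ _-_ (sym (pos-+ (suc m₁) n₂)) (one-plus-gaps K) ⟩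
      + (suc m₁ ℕ.+ n₂) - + suc (s ℕ.* suc K)      ≡⟨ pos-∸ (≤-trans room₁ (m≤m+n (suc m₁) n₂)) ⟩
      + (suc m₁ ℕ.+ n₂ ℕ.∸ suc (s ℕ.* suc K))      ≡⟨ cong +_ (sym (∸∸1≡∸suc (suc m₁ ℕ.+ n₂) (s ℕ.* suc K))) ⟩
      + X ∎
      where
      ∸∸1≡∸suc : ∀ a b → a ℕ.∸ b ℕ.∸ 1 ≡ a ℕ.∸ suc b
      ∸∸1≡∸suc a b = trans (∸-+-assoc a b 1) (cong (a ℕ.∸_) (+-comm b 1))

module TwoCircles (s : ℕ) where

  open import Data.Nat using (suc; pred; _+_; _*_; _∸_; _≤_; _≡ᵇ_)
  open import Data.Nat.Properties using (suc-injective; ≡ᵇ⇒≡; ≡⇒≡ᵇ)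
  open import Data.Bool using (Bool; true; T; _∧_)
  open import Data.Bool.Properties using (T-∧; T?)
  open import Data.Vec using (_∷_)
  open import Data.Fin using () renaming (zero to fzero)
  open import Data.Fin.Subset using (Subset)
  open import Data.List using (List; filter; length; cartesianProduct)
  open import Data.List.Membership.Propositional using () renaming (_∈_ to _∈ₗ_)
  open import Data.List.Membership.Propositional.Properties using (∈-filter⁺; ∈-filter⁻; ∈-cartesianProduct⁺)
  open import Data.List.Relation.Unary.Unique.Propositional using (Unique)
  import Data.List.Relation.Unary.Unique.Propositional.Properties as Unique
  open import Data.Nat.Combinatorics using (_C_)
  open import Data.Product using (_,_; proj₂)
  open import Function using (_∘_)
  open import Function.Bundles using (_⇔_; mk⇔; Equivalence)
  open import Relation.Binary.PropositionalEquality
    using (_≡_; refl; sym; trans; cong; cong₂; subst; module ≡-Reasoning)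
  open Equivalence using (to; from)
  open import Defs
  open BooleanVectors
  open NaturalConvolution
  open Scanning s
  open CircleSeparation s
  open ScannerCoefficients s

  admissible : ∀ {n₁ n₂} → ℕ → Subset₂ n₁ n₂ → Bool
  admissible K (A , B) = anchored (pred (size A)) A ∧ (circle s (size B) B ∧ (pred (size A) + size B ≡ᵇ K))

  ∋0⇒size : ∀ {n} (A : Subset n) → A ∋ 0 → size A ≡ suc (pred (size A))
  ∋0⇒size (true ∷ A) _ = refl

  admissible-correct : ∀ {n₁ n₂} K (X : Subset₂ n₁ n₂) → T (admissible K X) ⇔ InA s (suc K) n₁ n₂ X
  admissible-correct {n₁} {n₂} K (A , B) = mk⇔ sound complete
    where
    J = pred (size A)
    sound : T (admissible K (A , B)) → InA s (suc K) n₁ n₂ (A , B)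
    sound h =
      let (hA , hBK)       = to (T-∧ {anchored J A}) h
          (hB , hK)        = to (T-∧ {circle s (size B) B}) hBK
          (CA , A∋0 , |A|) = to (anchored-correct J A) hA
          (CB , _)         = to (circle-correct 0 s (size B) B refl) hB
      in (from (separated⇔circSpaced A) CA , from (separated⇔circSpaced B) CB) ,
         trans (sym (cong₂ _+_ (size≡∣∣ A) (size≡∣∣ B)))
               (trans (cong (_+ size B) |A|) (cong suc (≡ᵇ⇒≡ _ K hK))) ,
         contains A A∋0
      where
      contains : ∀ {n} (A : Subset n) → A ∋ 0 → Contains₁₁ {n₂ = n₂} (A , B)
      contains (x ∷ A) A∋0 = fzero , refl , ∋⇒∈ (x ∷ A) fzero A∋0
    complete : InA s (suc K) n₁ n₂ (A , B) → T (admissible K (A , B))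
    complete ((SA , SB) , card , (i , i≡0 , i∈A)) =
      from T-∧ (from (anchored-correct J A) (to (separated⇔circSpaced A) SA , A∋0 , ∋0⇒size A A∋0) ,
      from T-∧ (from (circle-correct 0 s (size B) B refl) (to (separated⇔circSpaced B) SB , refl) ,
                ≡⇒≡ᵇ _ K (suc-injective (trans (cong (_+ size B) (sym (∋0⇒size A A∋0)))
                                               (trans (cong₂ _+_ (size≡∣∣ A) (size≡∣∣ B)) card)))))
      where
      A∋0 : A ∋ 0
      A∋0 = subst (A ∋_) i≡0 (∈⇒∋ A i i∈A)

  admissibleList : ∀ n₁ n₂ → ℕ → List (Subset₂ n₁ n₂)
  admissibleList n₁ n₂ K = filter (T? ∘ admissible K) (cartesianProduct (allVecs n₁) (allVecs n₂))

  admissibleList-unique : ∀ n₁ n₂ K → Unique (admissibleList n₁ n₂ K)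
  admissibleList-unique n₁ n₂ K =
    Unique.filter⁺ (T? ∘ admissible K) (Unique.cartesianProduct⁺ (allVecs-unique n₁) (allVecs-unique n₂))

  admissibleList-∈ : ∀ n₁ n₂ K X → (X ∈ₗ admissibleList n₁ n₂ K) ⇔ InA s (suc K) n₁ n₂ X
  admissibleList-∈ n₁ n₂ K X@(A , B) = mk⇔
    (λ X∈L → to (admissible-correct K X)
                 (proj₂ (∈-filter⁻ (T? ∘ admissible K) {xs = cartesianProduct (allVecs n₁) (allVecs n₂)} X∈L)))
    (λ X∈A → ∈-filter⁺ (T? ∘ admissible K)
                 (∈-cartesianProduct⁺ (allVecs-complete n₁ A) (allVecs-complete n₂ B))
                 (from (admissible-correct K X) X∈A))

  admissible-count : ∀ n₁ n₂ K →
    length (admissibleList n₁ n₂ K)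
      ≡ convℕ (λ J → Σᵥ n₁ (λ A → ⟦ anchored J A ⟧)) (λ i → Σᵥ n₂ (λ B → ⟦ circle s i B ⟧)) K
  admissible-count n₁ n₂ K = begin
    length (admissibleList n₁ n₂ K)
      ≡⟨ count-pairs n₁ n₂ (admissible K) ⟩
    Σᵥ n₁ (λ A → Σᵥ n₂ (λ B → ⟦ admissible K (A , B) ⟧))
      ≡⟨ Σᵥ-cong n₁ (λ A → Σᵥ-cong n₂ (λ B → sym (single-split A B))) ⟩
    Σᵥ n₁ (λ A → Σᵥ n₂ (λ B → convℕ (λ J → ⟦ anchored J A ⟧) (λ i → ⟦ circle s i B ⟧) K))
      ≡⟨ Σᵥ-cong n₁ (λ A → Σᵥ-convʳ n₂ (λ J → ⟦ anchored J A ⟧) (λ i B → ⟦ circle s i B ⟧) K) ⟩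
    Σᵥ n₁ (λ A → convℕ (λ J → ⟦ anchored J A ⟧) (λ i → Σᵥ n₂ (λ B → ⟦ circle s i B ⟧)) K)
      ≡⟨ Σᵥ-convˡ n₁ (λ J A → ⟦ anchored J A ⟧) _ K ⟩
    convℕ (λ J → Σᵥ n₁ (λ A → ⟦ anchored J A ⟧)) (λ i → Σᵥ n₂ (λ B → ⟦ circle s i B ⟧)) K ∎
    where
    open ≡-Reasoning
    -- each pair is counted once, at J = |A| − 1 and i = |B|
    single-split : ∀ A B → convℕ (λ J → ⟦ anchored J A ⟧) (λ i → ⟦ circle s i B ⟧) K ≡ ⟦ admissible K (A , B) ⟧
    single-split A B = convℕ-tests (λ J → anchored J A) (λ i → circle s i B) (pred (size A)) (size B)
      (λ J h → cong pred (sym (proj₂ (proj₂ (to (anchored-correct J A) h)))))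
      (λ i h → sym (proj₂ (to (circle-correct 0 s i B refl) h)))
      K

  admissibleList-length : ∀ K m₁ n₂ → 1 ≤ s → suc (s * suc K) ≤ suc m₁ → s * suc K ≤ n₂ →
    length (admissibleList (suc m₁) n₂ K) ≡ (suc m₁ + n₂ ∸ s * suc K ∸ 1) C K
  admissibleList-length K m₁ n₂ 1≤s room₁ room₂ =
    trans (admissible-count (suc m₁) n₂ K) (scanner-convolution K m₁ n₂ 1≤s room₁ room₂)

open import Defs
open import Data.Nat using (_+_; _*_; _∸_; _≤_; suc; zero)
open import Data.Nat.Combinatorics using (_C_)
open import Data.List using (List; length)
open import Data.List.Membership.Propositional using (_∈_)
open import Data.List.Relation.Unary.Unique.Propositional using (Unique)
open import Data.Product using (_×_; Σ; _,_)
open import Function.Bundles using (_⇔_)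
open import Relation.Binary.PropositionalEquality using (_≡_)

theorem2 : (s k n₁ n₂ : ℕ) → 1 ≤ s → 1 ≤ k → 1 ≤ n₁ → 1 ≤ n₂ →
    suc (s * k) ≤ n₁ → s * k ≤ n₂ →
    Σ (List (Subset₂ n₁ n₂)) λ L →
      Unique L × (∀ X → (X ∈ L) ⇔ InA s k n₁ n₂ X) ×
      length L ≡ (n₁ + n₂ ∸ s * k ∸ 1) C (k ∸ 1)
theorem2 s zero    n₁       n₂ _   () _ _ _ _
theorem2 s (suc K) zero     n₂ _   _  () _ _ _
theorem2 s (suc K) (suc m₁) n₂ 1≤s _  _  _ room₁ room₂ =
  admissibleList (suc m₁) n₂ K ,
  admissibleList-unique (suc m₁) n₂ K ,
  admissibleList-∈ (suc m₁) n₂ K ,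
  admissibleList-length K m₁ n₂ 1≤s room₁ room₂
  where open TwoCircles s
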